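{- Let $\lambda,\mu\ge0$ and let $G$ be a meshed graph satisfying the $(\lambda,\mu)$-bow metric. Then every ball of $G$ is $k$-quasiconvex for some $k\le\max\{\lambda,\mu/2\}$.
   Context: Graphs are finite, simple, unweighted, undirected, connected, with shortest-path distance $d$. The interval is $I(u,v)=\{z: d(u,z)+d(z,v)=d(u,v)\}$; the ball is $B(w,r)=\{u:d(u,w)\le r\}$; for a set $S$, $B(S,\epsilon)=\{u: \min_{s\in S}d(u,s)\le\epsilon\}$. A set $S$ is $\epsilon$-quasiconvex if $I(x,y)\subseteq B(S,\epsilon)$ for all $x,y\in S$. $G$ is meshed if for any three vertices $u,v,w$ with $d(v,w)=2$ there is a common neighbor $x$ of $v$ and $w$ with $2d(u,x)\le d(u,v)+d(u,w)$. A graph satisfies the $(\lambda,\mu)$-bow metric if for all vertices $u,v,w,x$ with $v\in I(u,w)$, $w\in I(v,x)$ and $d(v,w)>\lambda$, one has $d(u,x)\ge d(u,v)+d(v,w)+d(w,x)-\mu$. -}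

module Defs where

open import Level using (0ℓ)
open import Data.Nat using (ℕ; zero; suc; _+_; _*_; _∸_; _≤_; _>_)
open import Data.Fin using (Fin)
open import Data.Product using (Σ; _×_; ∃; ∃-syntax)
open import Relation.Binary.PropositionalEquality using (_≡_)
open import Relation.Nullary using (¬_)

record Graph : Set₁ where
  field
    n     : ℕ
    Adj   : Fin n → Fin n → Set
    sym   : ∀ {u v} → Adj u v → Adj v u
    irrefl : ∀ {u} → ¬ Adj u u

module _ (G : Graph) where
  open Graph G

  Vertex : Set
  Vertex = Fin n

  data Walk : Vertex → Vertex → ℕ → Set where
    nil  : ∀ {u} → Walk u u 0
    cons : ∀ {u w v k} → Adj u w → Walk w v k → Walk u v (suc k)

  -- d is the shortest-path distance of G: d u v is the length of some walk
  -- from u to v, and no walk from u to v is shorter.  Requiring this for all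
  -- u v also forces G to be connected.
  IsShortestPathDistance : (Vertex → Vertex → ℕ) → Set
  IsShortestPathDistance d =
    ∀ u v → Walk u v (d u v) × (∀ k → Walk u v k → d u v ≤ k)

  module _ (d : Vertex → Vertex → ℕ) where

    Interval : Vertex → Vertex → Vertex → Set
    Interval u v z = d u z + d z v ≡ d u v

    Ball : Vertex → ℕ → Vertex → Set
    Ball w r u = d u w ≤ r

    NbhdSet : (Vertex → Set) → ℕ → Vertex → Set
    NbhdSet S ε u = ∃[ s ] (S s × d u s ≤ ε)

    Quasiconvex : ℕ → (Vertex → Set) → Set
    Quasiconvex ε S = ∀ x y → S x → S y → ∀ z → Interval x y z → NbhdSet S ε z

    Meshed : Set
    Meshed = ∀ u v w → d v w ≡ 2 →
      ∃[ x ] (Adj v x × Adj x w × 2 * d u x ≤ d u v + d u w)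

    BowMetric : ℕ → ℕ → Set
    BowMetric l m = ∀ u v w x → Interval u w v → Interval v x w → d v w > l →
      d u v + d v w + d w x ≤ d u x + m

{-# OPTIONS --safe #-}
module Submission where

-- In a meshed graph, a vertex v with d(c,x) < d(c,v) has a neighbour one step
-- closer to both c and x.  Iterating from z ∈ I(x,y) with x, y ∈ B(c,r) and
-- d(c,z) > l + r gives v ∈ I(c,z) ∩ I(x,z) with d(v,z) = l + 1; then z ∈ I(v,y),
-- and the bow metric for c, v, z, y together with d(c,z) ≤ r + d(z,y) yields
-- 2 d(c,z) ≤ 2 r + m.  Hence d(c,z) ≤ r + (l ⊔ ⌊m/2⌋), and a geodesic from z to c
-- reaches B(c,r) within that many steps.

open import Defs
open import Data.Nat using (ℕ; zero; suc; _+_; _*_; _∸_; _≤_; _<_; _⊔_; _/_; _≤?_; _<?_; z≤n)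
open import Data.Nat.Properties
open import Data.Nat.DivMod using (m*n/n≡m; m/n*n≤m; /-congˡ; /-monoˡ-≤; +-distrib-/-∣ˡ)
open import Data.Nat.Divisibility using (m∣m*n)
open import Algebra.Properties.CommutativeSemigroup +-commutativeSemigroup using (x∙yz≈y∙xz)
open import Data.Product using (_×_; _,_; proj₁; proj₂; ∃-syntax)
open import Data.Sum using (_⊎_; inj₁; inj₂)
open import Relation.Binary.PropositionalEquality using (_≡_; refl; sym; trans; cong; cong₂; subst)
open import Relation.Nullary using (yes; no; contradiction)
open ≤-Reasoning

2*n≡n+n : ∀ n → 2 * n ≡ n + n
2*n≡n+n n = cong (n +_) (+-identityʳ n)

2*n/2≡n : ∀ n → 2 * n / 2 ≡ n
2*n/2≡n n = trans (/-congˡ (*-comm 2 n)) (m*n/n≡m n 2)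

2*[n/2]≤n : ∀ n → 2 * (n / 2) ≤ n
2*[n/2]≤n n = ≤-trans (≤-reflexive (*-comm 2 (n / 2))) (m/n*n≤m n 2)

2*m≤2*n+o⇒m≤n+o/2 : ∀ {m n} o → 2 * m ≤ 2 * n + o → m ≤ n + o / 2
2*m≤2*n+o⇒m≤n+o/2 {m} {n} o le = begin
  m                 ≡⟨ 2*n/2≡n m ⟨
  2 * m / 2         ≤⟨ /-monoˡ-≤ 2 le ⟩
  (2 * n + o) / 2   ≡⟨ +-distrib-/-∣ˡ o (m∣m*n n) ⟩
  2 * n / 2 + o / 2 ≡⟨ cong (_+ o / 2) (2*n/2≡n n) ⟩
  n + o / 2         ∎

2*m<n+o⇒m≤n : ∀ {m n o} → 2 * m < n + o → o ≤ suc n → m ≤ n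
2*m<n+o⇒m≤n {m} {n} {o} lt o≤1+n = *-cancelˡ-≤ 2 (≤-pred (begin-strict
  2 * m       <⟨ lt ⟩
  n + o       ≤⟨ +-monoʳ-≤ n o≤1+n ⟩
  n + suc n   ≡⟨ +-suc n n ⟩
  suc (n + n) ≡⟨ cong suc (2*n≡n+n n) ⟨
  suc (2 * n) ∎))

2*m<n+n⇒m<n : ∀ {m n} → 2 * m < n + n → m < n
2*m<n+n⇒m<n {m} {n} lt = *-cancelˡ-< 2 m n (subst (2 * m <_) (sym (2*n≡n+n n)) lt)

module ShortestPaths (G : Graph) (d : Vertex G → Vertex G → ℕ)
                     (isDist : IsShortestPathDistance G d) where
  open Graph G using (Adj) renaming (sym to Adj-sym)

  _++_ : ∀ {u v w a b} → Walk G u v a → Walk G v w b → Walk G u w (a + b)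
  nil      ++ q = q
  cons e p ++ q = cons e (p ++ q)

  _∷ʳ_ : ∀ {u v w a} → Walk G u v a → Adj v w → Walk G u w (suc a)
  nil       ∷ʳ e = cons e nil
  cons e′ p ∷ʳ e = cons e′ (p ∷ʳ e)

  reverse : ∀ {u v a} → Walk G u v a → Walk G v u a
  reverse nil        = nil
  reverse (cons e p) = reverse p ∷ʳ Adj-sym e

  splitAt : ∀ {u v} a b → Walk G u v (a + b) → ∃[ s ] (Walk G u s a × Walk G s v b)
  splitAt zero    b p          = _ , nil , p
  splitAt (suc a) b (cons e p) = let s , p₁ , p₂ = splitAt a b p in s , cons e p₁ , p₂

  geodesic : ∀ u v → Walk G u v (d u v)
  geodesic u v = proj₁ (isDist u v)

  d-minimal : ∀ {u v k} → Walk G u v k → d u v ≤ k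
  d-minimal {u} {v} {k} = proj₂ (isDist u v) k

  d-triangle : ∀ u v w → d u w ≤ d u v + d v w
  d-triangle u v w = d-minimal (geodesic u v ++ geodesic v w)

  d-sym : ∀ u v → d u v ≡ d v u
  d-sym u v = ≤-antisym (d-minimal (reverse (geodesic v u))) (d-minimal (reverse (geodesic u v)))

  d-refl : ∀ u → d u u ≡ 0
  d-refl u = n≤0⇒n≡0 (d-minimal nil)

  d-adj : ∀ x {v w} → Adj v w → d x w ≤ suc (d x v)
  d-adj x {v} e = d-minimal (geodesic x v ∷ʳ e)

  d-split : ∀ {u v} a b → d u v ≤ a + b → ∃[ s ] (d u s ≤ a × d s v ≤ b)
  d-split {u} {v} a b uv≤a+b with d u v ≤? a
  ... | yes uv≤a = v , uv≤a , ≤-trans (≤-reflexive (d-refl v)) z≤n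
  ... | no  uv≰a =
    let s , p₁ , p₂ = splitAt a (d u v ∸ a) (subst (Walk G u v) uv≡a+rest (geodesic u v))
    in  s , d-minimal p₁ , ≤-trans (d-minimal p₂) (m≤n+o⇒m∸n≤o (d u v) a uv≤a+b)
    where
    uv≡a+rest : d u v ≡ a + (d u v ∸ a)
    uv≡a+rest = sym (m+[n∸m]≡n (<⇒≤ (≰⇒> uv≰a)))

  Ball⊆NbhdSet : ∀ c r k z → d z c ≤ k + r → NbhdSet G d (Ball G d c r) k z
  Ball⊆NbhdSet c r k z zc≤k+r = let s , zs≤k , sc≤r = d-split k r zc≤k+r in s , sc≤r , zs≤k

  interval-nested : ∀ {x y z v} → Interval G d x z v → Interval G d x y z → Interval G d v y z
  interval-nested {x} {y} {z} {v} x-v-z x-z-y = ≤-antisym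
    (+-cancelˡ-≤ (d x v) _ _ (begin
      d x v + (d v z + d z y) ≡⟨ +-assoc (d x v) (d v z) (d z y) ⟨
      d x v + d v z + d z y   ≡⟨ cong (_+ d z y) x-v-z ⟩
      d x z + d z y           ≡⟨ x-z-y ⟩
      d x y                   ≤⟨ d-triangle x v y ⟩
      d x v + d v y           ∎))
    (d-triangle v z y)

  Toward : Vertex G → Vertex G → Vertex G → Set
  Toward x v w = Adj v w × d x v ≡ suc (d x w)

  toward-if-closer : ∀ {x v w} → Adj v w → d x w < d x v → Toward x v w
  toward-if-closer {x} e xw<xv = e , ≤-antisym (d-adj x (Adj-sym e)) xw<xv

  toward-exists : ∀ {x v n} → d x v ≡ suc n → ∃[ w ] Toward x v w
  toward-exists {x} {v} {n} xv≡1+n with subst (Walk G v x) (trans (d-sym v x) xv≡1+n) (geodesic v x)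
  ... | cons {w = w} e p = w , toward-if-closer e (begin-strict
    d x w ≡⟨ d-sym x w ⟩
    d w x ≤⟨ d-minimal p ⟩
    n     <⟨ n<1+n n ⟩
    suc n ≡⟨ xv≡1+n ⟨
    d x v ∎)

  interval-step : ∀ {y z v w} → Toward y v w → Interval G d y z v → Interval G d y z w
  interval-step {y} {z} {v} {w} (e , yv≡1+yw) y-v-z = ≤-antisym
    (begin
      d y w + d w z         ≤⟨ +-monoʳ-≤ (d y w) (d-minimal (cons (Adj-sym e) (geodesic v z))) ⟩
      d y w + suc (d v z)   ≡⟨ +-suc (d y w) (d v z) ⟩
      suc (d y w) + d v z   ≡⟨ cong (_+ d v z) yv≡1+yw ⟨
      d y v + d v z         ≡⟨ y-v-z ⟩
      d y z                 ∎)
    (d-triangle y w z)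

  module Descent (meshed : Meshed G d) (c x : Vertex G) where

    TowardBoth : Vertex G → Vertex G → Set
    TowardBoth v w = Toward x v w × Toward c v w

    meshed-toward : ∀ {v a q} → Toward x v a → Toward x a q →
                    ∃[ m ] (Toward x v m × 2 * d c m ≤ d c v + d c q)
    meshed-toward {v} {a} {q} (v-a , xv≡1+xa) (a-q , xa≡1+xq) =
      let m , v-m , m-q , cm-mid = meshed c v q vq≡2 in
      m , toward-if-closer v-m (closer m-q) , cm-mid
      where
      xv≡2+xq : d x v ≡ 2 + d x q
      xv≡2+xq = trans xv≡1+xa (cong suc xa≡1+xq)

      vq≡2 : d v q ≡ 2
      vq≡2 = ≤-antisym (d-minimal (cons v-a (cons a-q nil))) (+-cancelʳ-≤ (d x q) 2 (d v q) (begin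
        2 + d x q     ≡⟨ xv≡2+xq ⟨
        d x v         ≤⟨ d-triangle x q v ⟩
        d x q + d q v ≡⟨ +-comm (d x q) (d q v) ⟩
        d q v + d x q ≡⟨ cong (_+ d x q) (d-sym q v) ⟩
        d v q + d x q ∎))

      closer : ∀ {m} → Adj m q → d x m < d x v
      closer {m} m-q = begin-strict
        d x m       ≤⟨ d-adj x (Adj-sym m-q) ⟩
        suc (d x q) <⟨ n<1+n _ ⟩
        2 + d x q   ≡⟨ xv≡2+xq ⟨
        d x v       ∎

    descent-step : ∀ {v a q} → Toward x v a → TowardBoth a q →
                   ∃[ m ] (Toward x v m × 2 * d c m < d c v + d c a)
    descent-step {v} {a} {q} v→a (a→q , (_ , ca≡1+cq)) =
      let m , v→m , cm-mid = meshed-toward v→a a→q in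
      m , v→m , (begin-strict
        2 * d c m           ≤⟨ cm-mid ⟩
        d c v + d c q       <⟨ +-monoʳ-< (d c v) (n<1+n (d c q)) ⟩
        d c v + suc (d c q) ≡⟨ cong (d c v +_) ca≡1+cq ⟨
        d c v + d c a       ∎)

    module _ {n v} (descent-below : ∀ u → d x u ≡ n → d c x < d c u → ∃[ w ] TowardBoth u w)
             (xv≡1+n : d x v ≡ suc n) (cx<cv : d c x < d c v) where

      improve : ∀ {a} → Toward x v a → d c v ≤ d c a →
                ∃[ m ] (Toward x v m × 2 * d c m < d c v + d c a)
      improve v→a cv≤ca =
        let _ , a⇉q = descent-below _ (suc-injective (trans (sym (proj₂ v→a)) xv≡1+n))
                                      (<-≤-trans cx<cv cv≤ca)
        in  descent-step v→a a⇉q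

      -- Step towards x; if that does not approach c, the meshed condition
      -- (applied at most twice) repairs the step.
      descent-suc : ∃[ w ] TowardBoth v w
      descent-suc with toward-exists xv≡1+n
      ... | p , v→p with d c p <? d c v
      ...   | yes cp<cv = p , v→p , toward-if-closer (proj₁ v→p) cp<cv
      ...   | no  cp≮cv with improve v→p (≮⇒≥ cp≮cv)
      ...     | m , v→m , 2cm<cv+cp with m≤n⇒m<n∨m≡n (2*m<n+o⇒m≤n 2cm<cv+cp (d-adj c (proj₁ v→p)))
      ...       | inj₁ cm<cv = m , v→m , toward-if-closer (proj₁ v→m) cm<cv
      ...       | inj₂ cm≡cv with improve v→m (≤-reflexive (sym cm≡cv))
      ...         | m′ , v→m′ , 2cm′<cv+cm = m′ , v→m′ , toward-if-closer (proj₁ v→m′)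
                      (2*m<n+n⇒m<n (subst (λ t → 2 * d c m′ < d c v + t) cm≡cv 2cm′<cv+cm))

    descent : ∀ n v → d x v ≡ n → d c x < d c v → ∃[ w ] TowardBoth v w
    descent zero v xv≡0 cx<cv = contradiction (begin
      d c v         ≤⟨ d-triangle c x v ⟩
      d c x + d x v ≡⟨ cong (d c x +_) xv≡0 ⟩
      d c x + 0     ≡⟨ +-identityʳ (d c x) ⟩
      d c x         ∎) (<⇒≱ cx<cv)
    descent (suc n) v = descent-suc (descent n)

    common-geodesic : ∀ z s → d c x + s ≤ d c z →
                      ∃[ v ] (d v z ≡ s × Interval G d c z v × Interval G d x z v)
    common-geodesic z zero _ = z , d-refl z , endpoint c , endpoint x
      where
      endpoint : ∀ u → Interval G d u z z
      endpoint u = trans (cong (d u z +_) (d-refl z)) (+-identityʳ (d u z))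
    common-geodesic z (suc s) cx+1+s≤cz
      with common-geodesic z s (≤-trans (+-monoʳ-≤ (d c x) (n≤1+n s)) cx+1+s≤cz)
    ... | v , vz≡s , c-v-z , x-v-z with descent (d x v) v refl cx<cv
      where
      cx<cv : d c x < d c v
      cx<cv = +-cancelʳ-≤ s (suc (d c x)) (d c v) (begin
        suc (d c x) + s ≡⟨ +-suc (d c x) s ⟨
        d c x + suc s   ≤⟨ cx+1+s≤cz ⟩
        d c z           ≡⟨ c-v-z ⟨
        d c v + d v z   ≡⟨ cong (d c v +_) vz≡s ⟩
        d c v + s       ∎)
    ...   | w , x-step , c-step@(_ , cv≡1+cw) = w , wz≡1+s , c-w-z , interval-step x-step x-v-z
      where
      c-w-z : Interval G d c z w
      c-w-z = interval-step c-step c-v-z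

      wz≡1+s : d w z ≡ suc s
      wz≡1+s = +-cancelˡ-≡ (d c w) (d w z) (suc s) (begin-equality
        d c w + d w z     ≡⟨ c-w-z ⟩
        d c z             ≡⟨ c-v-z ⟨
        d c v + d v z     ≡⟨ cong₂ _+_ cv≡1+cw vz≡s ⟩
        suc (d c w) + s   ≡⟨ +-suc (d c w) s ⟨
        d c w + suc s     ∎)

  module _ {l m : ℕ} (meshed : Meshed G d) (bow : BowMetric G d l m) where

    interval-in-ball : ∀ c r {x y z} → Ball G d c r x → Ball G d c r y → Interval G d x y z →
                       d z c ≤ l + r ⊎ 2 * d z c ≤ 2 * r + m
    interval-in-ball c r {x} {y} {z} xc≤r yc≤r x-z-y with d c z ≤? l + r
    ... | yes cz≤l+r = inj₁ (subst (_≤ l + r) (d-sym c z) cz≤l+r)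
    ... | no  cz≰l+r with Descent.common-geodesic meshed c x z (suc l) (begin
          d c x + suc l ≤⟨ +-monoˡ-≤ (suc l) (subst (_≤ r) (d-sym x c) xc≤r) ⟩
          r + suc l     ≡⟨ +-suc r l ⟩
          suc (r + l)   ≡⟨ cong suc (+-comm r l) ⟩
          suc (l + r)   ≤⟨ ≰⇒> cz≰l+r ⟩
          d c z         ∎)
    ...   | v , vz≡1+l , c-v-z , x-v-z = inj₂ (subst (λ t → 2 * t ≤ 2 * r + m) (d-sym c z) 2cz≤2r+m)
      where
      cy≤r : d c y ≤ r
      cy≤r = subst (_≤ r) (d-sym y c) yc≤r

      cz+zy≤r+m : d c z + d z y ≤ r + m
      cz+zy≤r+m = begin
        d c z + d z y         ≡⟨ cong (_+ d z y) c-v-z ⟨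
        d c v + d v z + d z y ≤⟨ bow c v z y c-v-z (interval-nested x-v-z x-z-y) (≤-reflexive (sym vz≡1+l)) ⟩
        d c y + m             ≤⟨ +-monoˡ-≤ m cy≤r ⟩
        r + m                 ∎

      cz≤r+zy : d c z ≤ r + d z y
      cz≤r+zy = begin
        d c z         ≤⟨ d-triangle c y z ⟩
        d c y + d y z ≤⟨ +-mono-≤ cy≤r (≤-reflexive (d-sym y z)) ⟩
        r + d z y     ∎

      2cz≤2r+m : 2 * d c z ≤ 2 * r + m
      2cz≤2r+m = begin
        2 * d c z           ≡⟨ 2*n≡n+n (d c z) ⟩
        d c z + d c z       ≤⟨ +-monoʳ-≤ (d c z) cz≤r+zy ⟩
        d c z + (r + d z y) ≡⟨ x∙yz≈y∙xz (d c z) r (d z y) ⟩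
        r + (d c z + d z y) ≤⟨ +-monoʳ-≤ r cz+zy≤r+m ⟩
        r + (r + m)         ≡⟨ +-assoc r r m ⟨
        r + r + m           ≡⟨ cong (_+ m) (2*n≡n+n r) ⟨
        2 * r + m           ∎

    ball-quasiconvex : ∀ c r → Quasiconvex G d (l ⊔ m / 2) (Ball G d c r)
    ball-quasiconvex c r x y x∈B y∈B z x-z-y = Ball⊆NbhdSet c r (l ⊔ m / 2) z zc≤k+r
      where
      zc≤k+r : d z c ≤ l ⊔ m / 2 + r
      zc≤k+r with interval-in-ball c r x∈B y∈B x-z-y
      ... | inj₁ zc≤l+r    = ≤-trans zc≤l+r (+-monoˡ-≤ r (m≤m⊔n l (m / 2)))
      ... | inj₂ 2zc≤2r+m = begin
        d z c         ≤⟨ 2*m≤2*n+o⇒m≤n+o/2 m 2zc≤2r+m ⟩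
        r + m / 2     ≡⟨ +-comm r (m / 2) ⟩
        m / 2 + r     ≤⟨ +-monoˡ-≤ r (m≤n⊔m l (m / 2)) ⟩
        l ⊔ m / 2 + r ∎

lemma3 : (l m : ℕ) (G : Graph) (d : Vertex G → Vertex G → ℕ) →
    IsShortestPathDistance G d →
    Meshed G d → BowMetric G d l m →
    ∃[ k ] ((k ≤ l ⊎ 2 * k ≤ m) ×
      (∀ (w : Vertex G) (r : ℕ) → Quasiconvex G d k (Ball G d w r)))
lemma3 l m G d isDist meshed bow =
  l ⊔ m / 2 , max-bound , ShortestPaths.ball-quasiconvex G d isDist meshed bow
  where
  max-bound : l ⊔ m / 2 ≤ l ⊎ 2 * (l ⊔ m / 2) ≤ m
  max-bound with ⊔-sel l (m / 2)
  ... | inj₁ k≡l   = inj₁ (≤-reflexive k≡l)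
  ... | inj₂ k≡m/2 = inj₂ (subst (λ k → 2 * k ≤ m) (sym k≡m/2) (2*[n/2]≤n m))
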